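{- Let $T=\langle m,n\rangle$ be a numerical semigroup of embedding dimension $2$ (minimally generated by $m$ and $n$), let $d\ge1$, and let $S=\{\mathbf{a}\in\mathbb{N}^d:|\mathbf{a}|\in T\}$ be the $T$-graded GNS. Then (a) $\operatorname{e}(S)=\binom{m+d-1}{d-1}+\binom{n+d-1}{d-1}$; (b) $\operatorname{t}(S)=\binom{mn-m-n+d-1}{d-1}$.
   Context: $\mathbb{N}$ is the set of non-negative integers; $|\mathbf{x}|$ is the sum of coordinates. For a GNS $S\subseteq\mathbb{N}^d$ (submonoid with finite complement $\operatorname{H}(S)$): $\operatorname{e}(S)$ is the cardinality of its minimal system of generators; $\operatorname{PF}(S)=\{\mathbf{x}\in\operatorname{H}(S):\mathbf{x}+\mathbf{s}\in S\ \forall\mathbf{s}\in S\setminus\{\mathbf{0}\}\}$, $\operatorname{t}(S)=|\operatorname{PF}(S)|$. -}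

module Defs where

open import Data.Nat using (ℕ; _+_; _*_)
open import Data.Vec using (Vec; zipWith; replicate; sum)
open import Data.List using (List; length)
open import Data.List.Membership.Propositional using (_∈_)
open import Data.List.Relation.Unary.Unique.Propositional using (Unique)
open import Data.Product using (Σ; ∃; ∃-syntax; _×_)
open import Relation.Nullary using (¬_)
open import Relation.Binary.PropositionalEquality using (_≡_; _≢_)
open import Function.Bundles using (_⇔_)

InT : ℕ → ℕ → ℕ → Set
InT m n k = ∃[ a ] ∃[ b ] (k ≡ a * m + b * n)

∣_∣ : ∀ {d} → Vec ℕ d → ℕ
∣ x ∣ = sum x

𝟎 : ∀ {d} → Vec ℕ d
𝟎 = replicate _ 0

_⊕_ : ∀ {d} → Vec ℕ d → Vec ℕ d → Vec ℕ d
_⊕_ = zipWith _+_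

Subset : ℕ → Set₁
Subset d = Vec ℕ d → Set

TGraded : (m n d : ℕ) → Subset d
TGraded m n d x = InT m n ∣ x ∣

-- Minimal generators of a (reduced) monoid S ⊆ ℕ^d: the unique minimal
-- system of generators is (S∖{0}) ∖ ((S∖{0}) + (S∖{0})).
MinGen : ∀ {d} → Subset d → Subset d
MinGen S x = S x × x ≢ 𝟎 ×
  ¬ (∃[ y ] ∃[ z ] (S y × y ≢ 𝟎 × S z × z ≢ 𝟎 × x ≡ y ⊕ z))

PF : ∀ {d} → Subset d → Subset d
PF S x = ¬ S x × (∀ s → S s → s ≢ 𝟎 → S (x ⊕ s))

HasCard : ∀ {d} → Subset d → ℕ → Set
HasCard {d} P k = Σ (List (Vec ℕ d)) λ l →
  Unique l × (∀ x → (x ∈ l) ⇔ P x) × length l ≡ k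

EmbDim : ∀ {d} → Subset d → ℕ → Set
EmbDim S k = HasCard (MinGen S) k

Type : ∀ {d} → Subset d → ℕ → Set
Type S k = HasCard (PF S) k

{-# OPTIONS --safe #-}
-- Membership in S depends only on the norm |x|, and every splitting |x| = i + j
-- lifts to a splitting x = y + z with |y| = i, |z| = j.  Hence the minimal
-- generators of S are the vectors whose norm is an atom of T = ⟨m, n⟩ (m or n),
-- and, for d ≥ 1, the pseudo-Frobenius elements of S are the vectors whose norm
-- is a pseudo-Frobenius number of T; by Sylvester's argument the only one is
-- m n - m - n.  Stars and bars: ℕ^d has C(k + d - 1, d - 1) vectors of norm k.
module Submission where

open import Defs
open import Data.Nat using (ℕ; _+_; _*_; _∸_; _≤_)
open import Data.Nat.Combinatorics using (_C_)
open import Data.Nat.Coprimality using (Coprime)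
open import Data.Product using (_×_)

open import Data.Nat using (zero; suc; _<_; s≤s; z<s)
open import Data.Nat.Properties
open import Data.Nat.Divisibility
  using (_∣_; divides; ∣-refl; _∣0; ∣m∣n⇒∣m+n; ∣m+n∣m⇒∣n; ∣⇒≤; n∣m*n; m∣m*n)
open import Data.Nat.Combinatorics using (nCn≡1; nCk+nC[k+1]≡[n+1]C[k+1])
open import Data.Nat.Coprimality using (coprime-divisor) renaming (sym to coprime-sym)
open import Data.Nat.Tactic.RingSolver using (solve-∀)
open import Algebra.Properties.CommutativeSemigroup +-commutativeSemigroup
  using (interchange; xy∙z≈xz∙y)
open import Data.Vec using (Vec; []; _∷_)
open import Data.Vec.Properties using (∷-injectiveʳ; zipWith-identityˡ)
open import Data.List using (List; []; [_]; map; _++_; length)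
open import Data.List.Properties using (length-++; length-map)
open import Data.List.Membership.Propositional using (_∈_)
open import Data.List.Membership.Propositional.Properties
  using (∈-map⁺; ∈-map⁻; ∈-++⁺ˡ; ∈-++⁺ʳ; ∈-++⁻)
open import Data.List.Relation.Unary.Any using (here)
open import Data.List.Relation.Unary.All using ([])
open import Data.List.Relation.Unary.AllPairs using ([]; _∷_)
open import Data.List.Relation.Unary.Unique.Propositional using (Unique)
import Data.List.Relation.Unary.Unique.Propositional.Properties as Unique
open import Data.Product using (∃-syntax; _,_)
open import Data.Sum using (_⊎_; inj₁; inj₂; [_,_]′)
import Data.Sum as Sum
open import Data.Empty using (⊥; ⊥-elim)
open import Function using (_∘_)
open import Relation.Nullary using (¬_)
open import Relation.Binary.PropositionalEquality hiding ([_])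
open import Function.Bundles using (_⇔_; mk⇔; Equivalence)
open import Function.Properties.Equivalence using () renaming (trans to ⇔-trans)
open import Function.Construct.Symmetry using (⇔-sym)

open Equivalence using (to; from)

∣𝟎∣≡0 : ∀ d → ∣ 𝟎 {d} ∣ ≡ 0
∣𝟎∣≡0 zero    = refl
∣𝟎∣≡0 (suc d) = ∣𝟎∣≡0 d

∣x∣≡0⇒x≡𝟎 : ∀ {d} (x : Vec ℕ d) → ∣ x ∣ ≡ 0 → x ≡ 𝟎
∣x∣≡0⇒x≡𝟎 []       _   = refl
∣x∣≡0⇒x≡𝟎 (0 ∷ x) ∣x∣≡0 = cong (0 ∷_) (∣x∣≡0⇒x≡𝟎 x ∣x∣≡0)

x≢𝟎⇒∣x∣≢0 : ∀ {d} {x : Vec ℕ d} → x ≢ 𝟎 → ∣ x ∣ ≢ 0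
x≢𝟎⇒∣x∣≢0 {x = x} x≢𝟎 = x≢𝟎 ∘ ∣x∣≡0⇒x≡𝟎 x

∣x∣≢0⇒x≢𝟎 : ∀ {d} {x : Vec ℕ d} → ∣ x ∣ ≢ 0 → x ≢ 𝟎
∣x∣≢0⇒x≢𝟎 {d} ∣x∣≢0 refl = ∣x∣≢0 (∣𝟎∣≡0 d)

∣k∷𝟎∣≡k : ∀ d k → ∣ k ∷ 𝟎 {d} ∣ ≡ k
∣k∷𝟎∣≡k d k = trans (cong (k +_) (∣𝟎∣≡0 d)) (+-identityʳ k)

∣⊕∣ : ∀ {d} (x y : Vec ℕ d) → ∣ x ⊕ y ∣ ≡ ∣ x ∣ + ∣ y ∣
∣⊕∣ []      []      = refl
∣⊕∣ (a ∷ x) (b ∷ y) = trans (cong (a + b +_) (∣⊕∣ x y)) (interchange a b ∣ x ∣ ∣ y ∣)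

suc-head : ∀ {d} → Vec ℕ (suc d) → Vec ℕ (suc d)
suc-head (a ∷ x) = suc a ∷ x

suc-head-injective : ∀ {d} {x y : Vec ℕ (suc d)} → suc-head x ≡ suc-head y → x ≡ y
suc-head-injective {x = _ ∷ _} {_ ∷ _} refl = refl

⊕-split : ∀ {d} (x : Vec ℕ d) i j → ∣ x ∣ ≡ i + j →
          ∃[ y ] ∃[ z ] (x ≡ y ⊕ z × ∣ y ∣ ≡ i × ∣ z ∣ ≡ j)
⊕-split {d} x zero j ∣x∣≡j =
  𝟎 , x , sym (zipWith-identityˡ (λ _ → refl) x) , ∣𝟎∣≡0 d , ∣x∣≡j
⊕-split (0 ∷ x) (suc i) j ∣x∣≡ with ⊕-split x (suc i) j ∣x∣≡
... | y , z , x≡y⊕z , ∣y∣≡ , ∣z∣≡ = 0 ∷ y , 0 ∷ z , cong (0 ∷_) x≡y⊕z , ∣y∣≡ , ∣z∣≡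
⊕-split (suc a ∷ x) (suc i) j ∣x∣≡ with ⊕-split (a ∷ x) i j (suc-injective ∣x∣≡)
... | b ∷ y , c ∷ z , x≡y⊕z , ∣y∣≡ , ∣z∣≡ =
  suc b ∷ y , c ∷ z , cong suc-head x≡y⊕z , cong suc ∣y∣≡ , ∣z∣≡

-- Splitting on whether the head is 0 mirrors Pascal's rule.
compositions : (d k : ℕ) → List (Vec ℕ d)
compositions d       zero    = [ 𝟎 ]
compositions zero    (suc k) = []
compositions (suc d) (suc k) =
  map (0 ∷_) (compositions d (suc k)) ++ map suc-head (compositions (suc d) k)

∈-compositions⁻ : ∀ d k {x} → x ∈ compositions d k → ∣ x ∣ ≡ k
∈-compositions⁻ d       zero    (here refl) = ∣𝟎∣≡0 d
∈-compositions⁻ (suc d) (suc k) x∈ with ∈-++⁻ (map (0 ∷_) (compositions d (suc k))) x∈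
... | inj₁ x∈₁ with ∈-map⁻ (0 ∷_) x∈₁
...   | y , y∈ , refl = ∈-compositions⁻ d (suc k) y∈
∈-compositions⁻ (suc d) (suc k) x∈ | inj₂ x∈₂ with ∈-map⁻ suc-head x∈₂
...   | _ ∷ _ , y∈ , refl = cong suc (∈-compositions⁻ (suc d) k y∈)

∈-compositions⁺ : ∀ d k (x : Vec ℕ d) → ∣ x ∣ ≡ k → x ∈ compositions d k
∈-compositions⁺ d       zero    x           ∣x∣≡0 = here (∣x∣≡0⇒x≡𝟎 x ∣x∣≡0)
∈-compositions⁺ (suc d) (suc k) (0 ∷ x)     ∣x∣≡  =
  ∈-++⁺ˡ (∈-map⁺ (0 ∷_) (∈-compositions⁺ d (suc k) x ∣x∣≡))
∈-compositions⁺ (suc d) (suc k) (suc a ∷ x) ∣x∣≡  =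
  ∈-++⁺ʳ (map (0 ∷_) (compositions d (suc k)))
    (∈-map⁺ suc-head (∈-compositions⁺ (suc d) k (a ∷ x) (suc-injective ∣x∣≡)))

compositions-unique : ∀ d k → Unique (compositions d k)
compositions-unique d       zero    = [] ∷ []
compositions-unique zero    (suc k) = []
compositions-unique (suc d) (suc k) =
  Unique.++⁺ (Unique.map⁺ ∷-injectiveʳ (compositions-unique d (suc k)))
             (Unique.map⁺ suc-head-injective (compositions-unique (suc d) k))
             disjoint
  where
  disjoint : ∀ {v} → ¬ (v ∈ map (0 ∷_) (compositions d (suc k)) ×
                        v ∈ map suc-head (compositions (suc d) k))
  disjoint (v∈₁ , v∈₂) with ∈-map⁻ (0 ∷_) v∈₁ | ∈-map⁻ suc-head v∈₂
  ... | _ , _ , refl | _ ∷ _ , _ , ()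

length-compositions : ∀ e k → length (compositions (suc e) k) ≡ (k + e) C e
length-compositions e       zero    = sym (nCn≡1 e)
length-compositions zero    (suc k) = trans (length-map suc-head (compositions 1 k)) (length-compositions zero k)
length-compositions (suc e) (suc k) = begin
  length (map (0 ∷_) zs ++ map suc-head ss)          ≡⟨ length-++ (map (0 ∷_) zs) ⟩
  length (map (0 ∷_) zs) + length (map suc-head ss)
    ≡⟨ cong₂ _+_ (length-map (0 ∷_) zs) (length-map suc-head ss) ⟩
  length zs + length ss
    ≡⟨ cong₂ _+_ (length-compositions e (suc k)) (length-compositions (suc e) k) ⟩
  suc (k + e) C e + (k + suc e) C suc e              ≡⟨ cong (λ t → suc (k + e) C e + t C suc e) (+-suc k e) ⟩
  suc (k + e) C e + suc (k + e) C suc e              ≡⟨ nCk+nC[k+1]≡[n+1]C[k+1] (suc (k + e)) e ⟩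
  suc (suc (k + e)) C suc e                          ≡⟨ cong (λ t → suc t C suc e) (+-suc k e) ⟨
  (suc k + suc e) C suc e                            ∎
  where
  open ≡-Reasoning
  zs : List (Vec ℕ (suc e))
  zs = compositions (suc e) (suc k)
  ss : List (Vec ℕ (suc (suc e)))
  ss = compositions (suc (suc e)) k

HasCard-⇔ : ∀ {d} {P Q : Subset d} {k} → (∀ x → P x ⇔ Q x) → HasCard Q k → HasCard P k
HasCard-⇔ P⇔Q (l , l-unique , ∈l⇔Q , length≡) =
  l , l-unique , (λ x → ⇔-trans (∈l⇔Q x) (⇔-sym (P⇔Q x))) , length≡

HasCard-⊎ : ∀ {d} {P Q : Subset d} {i j} → (∀ x → P x → Q x → ⊥) →
            HasCard P i → HasCard Q j → HasCard (λ x → P x ⊎ Q x) (i + j)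
HasCard-⊎ disjoint (l , l-unique , ∈l⇔P , refl) (l′ , l′-unique , ∈l′⇔Q , refl) =
  l ++ l′ ,
  Unique.++⁺ l-unique l′-unique (λ (x∈l , x∈l′) → disjoint _ (to (∈l⇔P _) x∈l) (to (∈l′⇔Q _) x∈l′)) ,
  (λ x → mk⇔ (Sum.map (to (∈l⇔P x)) (to (∈l′⇔Q x)) ∘ ∈-++⁻ l)
             [ ∈-++⁺ˡ ∘ from (∈l⇔P x) , ∈-++⁺ʳ l ∘ from (∈l′⇔Q x) ]′) ,
  length-++ l

HasCard-level : ∀ {d} k → 1 ≤ d → HasCard {d} (λ x → ∣ x ∣ ≡ k) ((k + d ∸ 1) C (d ∸ 1))
HasCard-level {suc e} k _ =
  compositions (suc e) k , compositions-unique (suc e) k ,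
  (λ x → mk⇔ (∈-compositions⁻ (suc e) k) (∈-compositions⁺ (suc e) k x)) ,
  trans (length-compositions e k) (cong (λ t → (t ∸ 1) C e) (sym (+-suc k e)))

Atom : (ℕ → Set) → ℕ → Set
Atom T k = T k × k ≢ 0 × ¬ (∃[ i ] ∃[ j ] (T i × i ≢ 0 × T j × j ≢ 0 × k ≡ i + j))

PseudoFrobenius : (ℕ → Set) → ℕ → Set
PseudoFrobenius T k = ¬ T k × (∀ t → T t → t ≢ 0 → T (k + t))

Graded : ∀ {d} → (ℕ → Set) → Subset d
Graded T x = T ∣ x ∣

MinGen-Graded : ∀ {d} (T : ℕ → Set) (x : Vec ℕ d) → MinGen (Graded T) x ⇔ Atom T ∣ x ∣
MinGen-Graded T x = mk⇔
  (λ (Tx , x≢𝟎 , indecomposable) → Tx , x≢𝟎⇒∣x∣≢0 x≢𝟎 ,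
     λ (i , j , Ti , i≢0 , Tj , j≢0 , ∣x∣≡i+j) →
       let y , z , x≡y⊕z , ∣y∣≡i , ∣z∣≡j = ⊕-split x i j ∣x∣≡i+j in
       indecomposable (y , z ,
         subst T (sym ∣y∣≡i) Ti , ∣x∣≢0⇒x≢𝟎 (i≢0 ∘ trans (sym ∣y∣≡i)) ,
         subst T (sym ∣z∣≡j) Tj , ∣x∣≢0⇒x≢𝟎 (j≢0 ∘ trans (sym ∣z∣≡j)) , x≡y⊕z))
  (λ (T∣x∣ , ∣x∣≢0 , atom) → T∣x∣ , ∣x∣≢0⇒x≢𝟎 ∣x∣≢0 ,
     λ (y , z , Ty , y≢𝟎 , Tz , z≢𝟎 , x≡y⊕z) →
       atom (∣ y ∣ , ∣ z ∣ , Ty , x≢𝟎⇒∣x∣≢0 y≢𝟎 , Tz , x≢𝟎⇒∣x∣≢0 z≢𝟎 ,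
             trans (cong ∣_∣ x≡y⊕z) (∣⊕∣ y z)))

-- Needs d ≥ 1 so that every t ∈ T is the norm of some vector, namely t ∷ 𝟎.
PF-Graded : ∀ {d} (T : ℕ → Set) (x : Vec ℕ (suc d)) → PF (Graded T) x ⇔ PseudoFrobenius T ∣ x ∣
PF-Graded {d} T x = mk⇔
  (λ (x∉S , x+S⊆S) → x∉S , λ t Tt t≢0 →
     subst T (trans (∣⊕∣ x (t ∷ 𝟎)) (cong (∣ x ∣ +_) (∣k∷𝟎∣≡k d t)))
       (x+S⊆S (t ∷ 𝟎) (subst T (sym (∣k∷𝟎∣≡k d t)) Tt)
                      (∣x∣≢0⇒x≢𝟎 (t≢0 ∘ trans (sym (∣k∷𝟎∣≡k d t))))))
  (λ (∣x∣∉T , ∣x∣+T⊆T) → ∣x∣∉T , λ s Ts s≢𝟎 →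
     subst T (sym (∣⊕∣ x s)) (∣x∣+T⊆T ∣ s ∣ Ts (x≢𝟎⇒∣x∣≢0 s≢𝟎)))

InT-+ : ∀ {m n i j} → InT m n i → InT m n j → InT m n (i + j)
InT-+ {m} {n} (a , b , refl) (a′ , b′ , refl) = a + a′ , b + b′ , regroup a b a′ b′ m n
  where
  regroup : ∀ a b a′ b′ m n → (a * m + b * n) + (a′ * m + b′ * n) ≡ (a + a′) * m + (b + b′) * n
  regroup = solve-∀

InT-comm : ∀ {m n k} → InT m n k → InT n m k
InT-comm {m} {n} (a , b , k≡) = b , a , trans k≡ (+-comm (a * m) (b * n))

InT-m : ∀ {m n} → InT m n m
InT-m {m} = 1 , 0 , sym (trans (+-identityʳ (m + 0)) (+-identityʳ m))

InT-n : ∀ {m n} → InT m n n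
InT-n = InT-comm InT-m

InT-<⇒∣ : ∀ {m n k} → InT m n k → k < m → n ∣ k
InT-<⇒∣ (zero , b , k≡) _ = divides b k≡
InT-<⇒∣ {m} {n} (suc a , b , refl) k<m =
  ⊥-elim (<⇒≱ k<m (≤-trans (m≤m+n m (a * m)) (m≤m+n (suc a * m) (b * n))))

Atom⇒≡summand : ∀ {T k i} j → Atom T k → T i → i ≢ 0 → T j → k ≡ i + j → k ≡ i
Atom⇒≡summand {i = i} zero _ _ _ _ k≡i+0 = trans k≡i+0 (+-identityʳ i)
Atom⇒≡summand (suc j) (_ , _ , indecomposable) Ti i≢0 Tj k≡ =
  ⊥-elim (indecomposable (_ , suc j , Ti , i≢0 , Tj , (λ ()) , k≡))

Atom-InT-comm : ∀ {m n k} → Atom (InT m n) k → Atom (InT n m) k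
Atom-InT-comm (Tk , k≢0 , indecomposable) = InT-comm Tk , k≢0 ,
  λ (i , j , Ti , i≢0 , Tj , j≢0 , k≡) →
    indecomposable (i , j , InT-comm Ti , i≢0 , InT-comm Tj , j≢0 , k≡)

-- Both summands of m are elements of ⟨m, n⟩ below m, hence multiples of n.
Atom-InT-m : ∀ {m n} → 1 < n → Coprime m n → Atom (InT m n) m
Atom-InT-m {m} {n} 1<n coprime =
  InT-m , (λ m≡0 → n∤m (subst (n ∣_) (sym m≡0) (n ∣0))) ,
  λ (i , j , Ti , i≢0 , Tj , j≢0 , m≡i+j) →
    n∤m (subst (n ∣_) (sym m≡i+j)
      (∣m∣n⇒∣m+n (InT-<⇒∣ Ti (subst (i <_) (sym m≡i+j) (m<m+n i (n≢0⇒n>0 j≢0))))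
                 (InT-<⇒∣ Tj (subst (j <_) (sym m≡i+j) (m<n+m j (n≢0⇒n>0 i≢0))))))
  where
  n∤m : ¬ n ∣ m
  n∤m n∣m = >⇒≢ 1<n (coprime (n∣m , ∣-refl))

Atom-InT⇒ : ∀ {m n k} → m ≢ 0 → n ≢ 0 → Atom (InT m n) k → k ≡ m ⊎ k ≡ n
Atom-InT⇒ {m} {n} m≢0 _ atom@((suc a , b , k≡) , _) =
  inj₁ (Atom⇒≡summand (a * m + b * n) atom InT-m m≢0 (a , b , refl)
                      (trans k≡ (+-assoc m (a * m) (b * n))))
Atom-InT⇒ {n = n} _ n≢0 atom@((zero , suc b , k≡) , _) =
  inj₂ (Atom⇒≡summand (b * n) atom InT-n n≢0 (0 , b , refl) k≡)
Atom-InT⇒ _ _ ((zero , zero , k≡0) , k≢0 , _) = ⊥-elim (k≢0 k≡0)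

1<⇒≢0 : ∀ {m} → 1 < m → m ≢ 0
1<⇒≢0 1<m = >⇒≢ (<-trans z<s 1<m)

Atom-InT⇔ : ∀ {m n k} → 1 < m → 1 < n → Coprime m n → Atom (InT m n) k ⇔ (k ≡ m ⊎ k ≡ n)
Atom-InT⇔ 1<m 1<n coprime = mk⇔
  (Atom-InT⇒ (1<⇒≢0 1<m) (1<⇒≢0 1<n))
  [ (λ { refl → Atom-InT-m 1<n coprime }) ,
    (λ { refl → Atom-InT-comm (Atom-InT-m 1<m (coprime-sym coprime)) }) ]′

F+m∈InT : ∀ {m n F} → F + m + n ≡ m * n → InT m n (F + m)
F+m∈InT {zero}  {n} {F} F+0+n≡0 = 0 , 0 , m+n≡0⇒m≡0 (F + 0) F+0+n≡0
F+m∈InT {suc m} {n} {F} F+m+n≡mn =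
  0 , m , +-cancelʳ-≡ n (F + suc m) (m * n) (trans F+m+n≡mn (+-comm n (m * n)))

F+n∈InT : ∀ {m n F} → F + m + n ≡ m * n → InT m n (F + n)
F+n∈InT {m} {n} {F} F+m+n≡mn =
  InT-comm (F+m∈InT (trans (xy∙z≈xz∙y F n m) (trans F+m+n≡mn (*-comm m n))))

F+InT⊆InT : ∀ {m n F t} → F + m + n ≡ m * n → InT m n t → t ≢ 0 → InT m n (F + t)
F+InT⊆InT {m} {n} {F} F+m+n≡mn (suc a , b , refl) _ =
  subst (InT m n)
    (trans (+-assoc F m (a * m + b * n)) (cong (F +_) (sym (+-assoc m (a * m) (b * n)))))
    (InT-+ (F+m∈InT F+m+n≡mn) (a , b , refl))
F+InT⊆InT {m} {n} {F} F+m+n≡mn (zero , suc b , refl) _ =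
  subst (InT m n) (+-assoc F n (b * n)) (InT-+ (F+n∈InT F+m+n≡mn) (0 , b , refl))
F+InT⊆InT _ (zero , zero , refl) t≢0 = ⊥-elim (t≢0 refl)

-- If F = a m + b n then (a + 1) m + (b + 1) n = m n, so m ∣ b + 1 and already
-- (b + 1) n ≥ m n leaves no room for (a + 1) m.
F∉InT : ∀ {m n F} → m ≢ 0 → Coprime m n → F + m + n ≡ m * n → ¬ InT m n F
F∉InT {m} {n} m≢0 coprime F+m+n≡mn (a , b , refl) = m≢0 (n≤0⇒n≡0 m≤0)
  where
  shift : ∀ a b m n → suc a * m + suc b * n ≡ (a * m + b * n) + m + n
  shift = solve-∀
  sum≡mn : suc a * m + suc b * n ≡ m * n
  sum≡mn = trans (shift a b m n) F+m+n≡mn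
  m∣suc-b : m ∣ suc b
  m∣suc-b = coprime-divisor coprime (subst (m ∣_) (*-comm (suc b) n)
    (∣m+n∣m⇒∣n (subst (m ∣_) (sym sum≡mn) (m∣m*n n)) (n∣m*n (suc a))))
  m≤0 : m ≤ 0
  m≤0 = +-cancelʳ-≤ (m * n) m 0 (begin
    m + m * n               ≤⟨ +-mono-≤ (m≤m+n m (a * m)) (*-monoˡ-≤ n (∣⇒≤ m∣suc-b)) ⟩
    suc a * m + suc b * n   ≡⟨ sum≡mn ⟩
    m * n                   ∎)
    where open ≤-Reasoning

gap+m∈InT⇒n∣ : ∀ {m n k} → ¬ InT m n k → InT m n (k + m) → n ∣ k + m
gap+m∈InT⇒n∣ _ (zero , b , k+m≡) = divides b k+m≡
gap+m∈InT⇒n∣ {m} {n} {k} k∉T (suc a , b , k+m≡) =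
  ⊥-elim (k∉T (a , b , +-cancelʳ-≡ m k (a * m + b * n)
    (trans k+m≡ (trans (+-assoc m (a * m) (b * n)) (+-comm m (a * m + b * n))))))

coprime-∣⇒*∣ : ∀ {m n x} → Coprime m n → m ∣ x → n ∣ x → m * n ∣ x
coprime-∣⇒*∣ {m} {n} coprime m∣x (divides q refl)
  with coprime-divisor coprime (subst (m ∣_) (*-comm q n) m∣x)
... | divides j refl = divides j (*-assoc j m n)

+m+n≡[2+i]mn⇒InT : ∀ {m n k} i → m ≢ 0 → n ≢ 0 → k + m + n ≡ suc (suc i) * (m * n) → InT m n k
+m+n≡[2+i]mn⇒InT {zero}  _ m≢0 _   _ = ⊥-elim (m≢0 refl)
+m+n≡[2+i]mn⇒InT {suc m} {zero} _ _ n≢0 _ = ⊥-elim (n≢0 refl)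
+m+n≡[2+i]mn⇒InT {suc m} {suc n} {k} i _ _ k+m+n≡ =
  i * suc n + n , m ,
  +-cancelʳ-≡ (suc m) k _ (+-cancelʳ-≡ (suc n) (k + suc m) _ (trans k+m+n≡ (expand i m n)))
  where
  expand : ∀ i m n → suc (suc i) * (suc m * suc n)
                   ≡ ((i * suc n + n) * suc m + m * suc n) + suc m + suc n
  expand = solve-∀

-- k + m and k + n lie in ⟨m, n⟩ but k does not, so n ∣ k + m and m ∣ k + n;
-- hence m n ∣ k + m + n, and any multiple beyond m n would put k in ⟨m, n⟩.
PseudoFrobenius-InT⇒ : ∀ {m n k} → m ≢ 0 → n ≢ 0 → Coprime m n →
                       PseudoFrobenius (InT m n) k → k + m + n ≡ m * n
PseudoFrobenius-InT⇒ {m} {n} {k} m≢0 n≢0 coprime (k∉T , k+T⊆T)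
  with coprime-∣⇒*∣ coprime m∣k+m+n n∣k+m+n
  where
  n∣k+m+n : n ∣ k + m + n
  n∣k+m+n = ∣m∣n⇒∣m+n (gap+m∈InT⇒n∣ k∉T (k+T⊆T m InT-m m≢0)) ∣-refl
  m∣k+m+n : m ∣ k + m + n
  m∣k+m+n = subst (m ∣_) (xy∙z≈xz∙y k n m)
    (∣m∣n⇒∣m+n (gap+m∈InT⇒n∣ (k∉T ∘ InT-comm) (InT-comm (k+T⊆T n InT-n n≢0))) ∣-refl)
... | divides zero k+m+n≡0 = ⊥-elim (m≢0 (m+n≡0⇒n≡0 k (m+n≡0⇒m≡0 (k + m) k+m+n≡0)))
... | divides 1 k+m+n≡mn = trans k+m+n≡mn (+-identityʳ (m * n))
... | divides (suc (suc i)) k+m+n≡ = ⊥-elim (k∉T (+m+n≡[2+i]mn⇒InT i m≢0 n≢0 k+m+n≡))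

k+m+n∸m∸n≡k : ∀ k m n → k + m + n ∸ m ∸ n ≡ k
k+m+n∸m∸n≡k k m n =
  trans (∸-+-assoc (k + m + n) m n) (trans (cong (_∸ (m + n)) (+-assoc k m n)) (m+n∸n≡m k (m + n)))

frobenius+m+n≡mn : ∀ {m n} → 1 < m → 1 < n → m * n ∸ m ∸ n + m + n ≡ m * n
frobenius+m+n≡mn {m@(suc (suc p))} {n@(suc (suc q))} (s≤s (s≤s _)) (s≤s (s≤s _)) =
  trans (cong (λ l → l ∸ m ∸ n + m + n) mn≡)
        (trans (cong (λ k → k + m + n) (k+m+n∸m∸n≡k F m n)) (sym mn≡))
  where
  F : ℕ
  F = p * q + p + q
  mn≡ : m * n ≡ F + m + n
  mn≡ = expand p q
    where
    expand : ∀ p q → suc (suc p) * suc (suc q) ≡ p * q + p + q + suc (suc p) + suc (suc q)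
    expand = solve-∀

PseudoFrobenius-InT⇔ : ∀ {m n k} → 1 < m → 1 < n → Coprime m n →
                       PseudoFrobenius (InT m n) k ⇔ k ≡ m * n ∸ m ∸ n
PseudoFrobenius-InT⇔ {m} {n} {k} 1<m 1<n coprime = mk⇔
  (λ pf → +-cancelʳ-≡ m k _ (+-cancelʳ-≡ n (k + m) _
     (trans (PseudoFrobenius-InT⇒ (1<⇒≢0 1<m) (1<⇒≢0 1<n) coprime pf) (sym F+m+n≡mn))))
  (λ { refl → F∉InT (1<⇒≢0 1<m) coprime F+m+n≡mn , λ _ → F+InT⊆InT F+m+n≡mn })
  where
  F+m+n≡mn : m * n ∸ m ∸ n + m + n ≡ m * n
  F+m+n≡mn = frobenius+m+n≡mn 1<m 1<n

coprime⇒≢ : ∀ {m n} → 1 < m → Coprime m n → m ≢ n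
coprime⇒≢ {m} 1<m coprime m≡n = >⇒≢ 1<m (coprime (∣-refl , subst (m ∣_) m≡n ∣-refl))

corollary4p7 : (m n d : ℕ) → 2 ≤ m → 2 ≤ n → Coprime m n → 1 ≤ d →
    EmbDim (TGraded m n d) (((m + d ∸ 1) C (d ∸ 1)) + ((n + d ∸ 1) C (d ∸ 1)))
    × Type (TGraded m n d) ((m * n ∸ m ∸ n + d ∸ 1) C (d ∸ 1))
corollary4p7 m n (suc d) 1<m 1<n coprime 1≤d =
  HasCard-⇔ (λ x → ⇔-trans (MinGen-Graded (InT m n) x) (Atom-InT⇔ 1<m 1<n coprime))
    (HasCard-⊎ (λ _ ∣x∣≡m ∣x∣≡n → coprime⇒≢ 1<m coprime (trans (sym ∣x∣≡m) ∣x∣≡n))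
               (HasCard-level m 1≤d) (HasCard-level n 1≤d)) ,
  HasCard-⇔ (λ x → ⇔-trans (PF-Graded (InT m n) x) (PseudoFrobenius-InT⇔ 1<m 1<n coprime))
    (HasCard-level (m * n ∸ m ∸ n) 1≤d)
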